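{- For every $n\ge1$ and every leveled tree $T$ with $n+1$ leaves, $g(\Theta(T))=\Theta_P(f(T))$; that is, the Tonks map satisfies $\Theta=g^{ -1}\circ\Theta_P\circ f$.
   Context: Trees: planar rooted trees with $n+1$ leaves, labeled $0,1,\dots,n$ from left to right, in which every internal node has at least two children. For an internal node $x$ the leaves descending from $x$ form an interval $\{a_x,\dots,b_x\}$ with $a_x<b_x$. For $j\in[n]=\{1,\dots,n\}$, the gap $j$ (between leaves $j-1$ and $j$) is assigned to the lowest common ancestor of leaves $j-1$ and $j$. A leveled tree with $k$ levels is such a tree together with a surjection $\lambda$ from its internal nodes onto $[k]$ such that $\lambda(x)<\lambda(y)$ whenever $x$ is a proper descendant of $y$ (levels numbered top to bottom); it corresponds to the ordered partition $(B_1,\dots,B_k)$ of $[n]$ where $B_i$ is the set of gaps assigned to internal nodes of level $i$. The Tonks map $\Theta$ sends a leveled tree to its underlying planar tree (forgetting $\lambda$). Tubings: for a finite simple graph with node set $V$, a tube is a nonempty node set inducing a connected subgraph, $V$ is the universal tube, two tubes are compatible if nested or far apart (union not inducing a connected subgraph), and a tubing is a set of pairwise compatible tubes containing $V$. Let $K_n$ be the complete graph and $P_n$ the path graph on nodes $1,\dots,n$ ($i$ adjacent to $i+1$). Define $f(T)=\{B_1\cup\cdots\cup B_i: i=1,\dots,k\}$, a tubing of $K_n$. For a planar tree $S$ define $g(S)=\{\{a_x+1,\dots,b_x\}: x \text{ an internal node of } S\}$, a tubing of $P_n$ ($g$ is a bijection onto tubings of $P_n$). For a tubing $U$ of $K_n$,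 $\Theta_P(U)$ is the tubing of $P_n$ obtained by replacing each tube of $U$ by its connected components in $P_n$ (its maximal runs of consecutive integers); this is the composite of the edge-deletion maps $\Theta_e$ over all edges $e$ of $K_n$ not in $P_n$. -}

module Defs where

open import Data.Nat using (ℕ; zero; suc; _+_; _∸_; _≤_; _<_)
open import Data.Fin using (Fin; toℕ)
import Data.Fin as F
open import Data.Fin.Subset using (Subset; _∈_)
open import Data.List using (List; []; _∷_)
open import Data.Product using (Σ; ∃; ∃-syntax; _×_)
open import Relation.Nullary using (¬_)
open import Relation.Binary.PropositionalEquality using (_≡_)
open import Function.Bundles using (_⇔_)

-- Planar rooted trees in which every internal node has ≥ 2 children.
-- node c₁ c₂ cs has children c₁ , c₂ , cs (left to right).

data Tree : Set where
  leaf : Tree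
  node : Tree → Tree → List Tree → Tree

mutual
  leaves : Tree → ℕ
  leaves leaf = 1
  leaves (node s t ts) = leaves s + leaves t + leavesL ts

  leavesL : List Tree → ℕ
  leavesL [] = 0
  leavesL (t ∷ ts) = leaves t + leavesL ts

mutual
  data IPos : Tree → Set where
    here : ∀ {s t ts} → IPos (node s t ts)
    inL  : ∀ {s t ts} → IPos s → IPos (node s t ts)
    inM  : ∀ {s t ts} → IPos t → IPos (node s t ts)
    inR  : ∀ {s t ts} → IPosL ts → IPos (node s t ts)

  data IPosL : List Tree → Set where
    hd : ∀ {t ts} → IPos t → IPosL (t ∷ ts)
    tl : ∀ {t ts} → IPosL ts → IPosL (t ∷ ts)

mutual
  sub : (t : Tree) → IPos t → Tree
  sub t here = t
  sub (node s t ts) (inL p) = sub s p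
  sub (node s t ts) (inM p) = sub t p
  sub (node s t ts) (inR p) = subL ts p

  subL : (ts : List Tree) → IPosL ts → Tree
  subL (t ∷ ts) (hd p) = sub t p
  subL (t ∷ ts) (tl p) = subL ts p

-- Label of the leftmost leaf below an internal node (leaves labelled 0,1,…).
mutual
  off : (t : Tree) → IPos t → ℕ
  off t here = 0
  off (node s t ts) (inL p) = off s p
  off (node s t ts) (inM p) = leaves s + off t p
  off (node s t ts) (inR p) = leaves s + leaves t + offL ts p

  offL : (ts : List Tree) → IPosL ts → ℕ
  offL (t ∷ ts) (hd p) = off t p
  offL (t ∷ ts) (tl p) = leaves t + offL ts p

aₓ : (t : Tree) → IPos t → ℕ
aₓ t x = off t x

bₓ : (t : Tree) → IPos t → ℕ
bₓ t x = off t x + leaves (sub t x) ∸ 1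

-- Below t x y : x is a proper descendant of y.
mutual
  data Below : (t : Tree) → IPos t → IPos t → Set where
    hL : ∀ {s t ts p} → Below (node s t ts) (inL p) here
    hM : ∀ {s t ts p} → Below (node s t ts) (inM p) here
    hR : ∀ {s t ts p} → Below (node s t ts) (inR p) here
    lL : ∀ {s t ts p q} → Below s p q → Below (node s t ts) (inL p) (inL q)
    lM : ∀ {s t ts p q} → Below t p q → Below (node s t ts) (inM p) (inM q)
    lR : ∀ {s t ts p q} → BelowL ts p q → Below (node s t ts) (inR p) (inR q)

  data BelowL : (ts : List Tree) → IPosL ts → IPosL ts → Set where
    bhd : ∀ {t ts p q} → Below t p q → BelowL (t ∷ ts) (hd p) (hd q)
    btl : ∀ {t ts p q} → BelowL ts p q → BelowL (t ∷ ts) (tl p) (tl q)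

LeafBelow : (t : Tree) → IPos t → ℕ → Set
LeafBelow t x ℓ = aₓ t x ≤ ℓ × ℓ ≤ bₓ t x

CommonAnc : (t : Tree) → ℕ → IPos t → Set
CommonAnc t j x = LeafBelow t x (j ∸ 1) × LeafBelow t x j

-- Gap j (j ≥ 1) is assigned to x: x is the lowest common ancestor of
-- leaves j-1 and j (a common ancestor with no proper descendant that is one).
Assigned : (t : Tree) → ℕ → IPos t → Set
Assigned t j x = CommonAnc t j x × (∀ y → Below t y x → ¬ CommonAnc t j y)

-- Leveled trees. Levels [k] = {1,…,k} are represented by Fin k
-- (level i ↔ the element of Fin k with toℕ = i-1).

record Leveled : Set where
  field
    tree : Tree
    k    : ℕ
    lev  : IPos tree → Fin k
    surj : ∀ (i : Fin k) → ∃[ x ] lev x ≡ i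
    mono : ∀ x y → Below tree x y → lev x F.< lev y
open Leveled public

Θ : Leveled → Tree
Θ T = tree T

-- Tubes are subsets of [n]; element j : Fin n stands for the integer
-- toℕ j + 1.  A set of tubes is represented by a predicate on Subset n.

Family : ℕ → Set₁
Family n = Subset n → Set

-- integer m ∈ [n] lies in X (false for m outside [n])
In : ∀ {n} → Subset n → ℕ → Set
In {n} X m = ∃[ j ] (suc (toℕ j) ≡ m × j ∈ X)

IsInterval : ∀ {n} → Subset n → ℕ → ℕ → Set
IsInterval {n} X a b = ∀ (j : Fin n) → (j ∈ X) ⇔ (a < suc (toℕ j) × suc (toℕ j) ≤ b)

-- f(T) = { B₁ ∪ ⋯ ∪ Bᵢ : i ∈ [k] }, B_l = gaps assigned to nodes of level l.
f : (n : ℕ) → Leveled → Family n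
f n T X = Σ (Fin (k T)) λ i → (∀ (j : Fin n) →
  (j ∈ X) ⇔ (∃[ x ] (Assigned (tree T) (suc (toℕ j)) x × lev T x F.≤ i)))

g : (n : ℕ) → Tree → Family n
g n S X = ∃[ x ] IsInterval X (aₓ S x) (bₓ S x)

-- X is a connected component of Y in P_n: a maximal run {a+1,…,b} ⊆ Y.
IsComponent : ∀ {n} → Subset n → Subset n → Set
IsComponent Y X = ∃[ a ] ∃[ b ] (a < b × IsInterval X a b
  × (∀ m → a < m → m ≤ b → In Y m) × ¬ In Y a × ¬ In Y (suc b))

ΘP : (n : ℕ) → Family n → Family n
ΘP n U X = ∃[ Y ] (U Y × IsComponent Y X)

module Submission where

-- For an internal node x of a tree write [off x , hi x) for the half-open
-- range of leaves below x (so hi x = bₓ + 1), and say that x spans gap m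
-- when off x < m < hi x; spanning gap m is the same as being a common
-- ancestor of leaves m-1 and m.  Leaf ranges are nested along the
-- descendant order and laminar: two nodes whose ranges overlap are
-- comparable.  For a leveled tree T and a level i, the tube B₁ ∪ ⋯ ∪ Bᵢ of
-- f(T) is the set Dᵢ of gaps spanned by some node of level ≤ i, since the
-- lowest node spanning a gap has the smallest level among those spanning it.
--   (⊆) A node x of level i spans a run of Dᵢ whose outer gaps off x and
--       hi x are not in Dᵢ (by laminarity, as levels increase strictly
--       upwards), so {aₓ+1,…,bₓ} is a connected component of Dᵢ.
--   (⊇) For a component {a+1,…,b} of Dᵢ, go up from a node of level ≤ i
--       spanning a+1 to its topmost ancestor of level ≤ i; maximality of the
--       run forces that node's leaf range to be exactly [a , b+1).
-- The file develops leaf ranges, then searches over node positions, then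
-- spanning, then the level tubes Dᵢ, and finally the theorem.

open import Defs
open import Data.Nat using (ℕ; zero; suc; _+_; _≤_; _<_; z≤n; s≤s; s≤s⁻¹)
open import Data.Nat.Properties
open import Data.Fin using (Fin; toℕ; fromℕ<)
import Data.Fin as F
import Data.Fin.Properties as FP
open import Data.Fin.Induction using (<-wellFounded)
open import Data.Fin.Subset using (Subset; _∈_)
open import Data.Bool.Properties using (T-≡)
open import Data.Vec using (tabulate)
open import Data.Vec.Properties using (lookup∘tabulate; []=⇒lookup; lookup⇒[]=)
open import Data.List using (List; []; _∷_)
open import Data.Product using (Σ; ∃-syntax; _×_; _,_; proj₁; proj₂)
import Data.Product as Product
open import Data.Sum using (_⊎_; inj₁; inj₂)
import Data.Sum as Sum
open import Data.Empty using (⊥-elim)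
open import Induction.WellFounded using (Acc; acc)
open import Relation.Nullary using (¬_; Dec; yes; no)
open import Relation.Nullary.Decidable using (_×-dec_; isYes; toWitness; fromWitness)
open import Relation.Binary.PropositionalEquality
open import Function using (_∘_)
open import Function.Bundles using (_⇔_; mk⇔; Equivalence)
import Function.Properties.Equivalence as ⇔
open Equivalence using (to; from)

-- hi t x is one past the last leaf below x.  It is defined by recursion on
-- the position so that it unfolds definitionally, like off.
mutual
  hi : (t : Tree) → IPos t → ℕ
  hi t here = leaves t
  hi (node s u us) (inL p) = hi s p
  hi (node s u us) (inM p) = leaves s + hi u p
  hi (node s u us) (inR p) = leaves s + leaves u + hiL us p

  hiL : (ts : List Tree) → IPosL ts → ℕ
  hiL (u ∷ us) (hd p) = hi u p
  hiL (u ∷ us) (tl p) = leaves u + hiL us p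

+-shift : ∀ c {h o z} → h ≡ o + z → c + h ≡ c + o + z
+-shift c {o = o} {z} e = trans (cong (c +_) e) (sym (+-assoc c o z))

mutual
  hi≡off+size : ∀ t x → hi t x ≡ off t x + leaves (sub t x)
  hi≡off+size t here = refl
  hi≡off+size (node s u us) (inL p) = hi≡off+size s p
  hi≡off+size (node s u us) (inM p) = +-shift (leaves s) (hi≡off+size u p)
  hi≡off+size (node s u us) (inR p) = +-shift (leaves s + leaves u) (hiL≡offL+size us p)

  hiL≡offL+size : ∀ ts x → hiL ts x ≡ offL ts x + leaves (subL ts x)
  hiL≡offL+size (u ∷ us) (hd p) = hi≡off+size u p
  hiL≡offL+size (u ∷ us) (tl p) = +-shift (leaves u) (hiL≡offL+size us p)

leaves≥1 : ∀ t → 1 ≤ leaves t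
leaves≥1 leaf = ≤-refl
leaves≥1 (node s u us) =
  ≤-trans (leaves≥1 s) (≤-trans (m≤m+n (leaves s) (leaves u)) (m≤m+n _ (leavesL us)))

mutual
  size≥2 : ∀ t x → 2 ≤ leaves (sub t x)
  size≥2 (node s u us) here =
    ≤-trans (+-mono-≤ (leaves≥1 s) (leaves≥1 u)) (m≤m+n _ (leavesL us))
  size≥2 (node s u us) (inL p) = size≥2 s p
  size≥2 (node s u us) (inM p) = size≥2 u p
  size≥2 (node s u us) (inR p) = size≥2L us p

  size≥2L : ∀ ts x → 2 ≤ leaves (subL ts x)
  size≥2L (u ∷ us) (hd p) = size≥2 u p
  size≥2L (u ∷ us) (tl p) = size≥2L us p

hi≡suc-bₓ : ∀ t x → hi t x ≡ suc (bₓ t x)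
hi≡suc-bₓ t x = trans (hi≡off+size t x) (sym (m+[n∸m]≡n 1≤range))
  where
  1≤range : 1 ≤ off t x + leaves (sub t x)
  1≤range = ≤-trans (≤-trans (s≤s z≤n) (size≥2 t x)) (m≤n+m _ (off t x))

aₓ<bₓ : ∀ t x → aₓ t x < bₓ t x
aₓ<bₓ t x = s≤s⁻¹ (begin
  suc (suc (off t x))          ≡⟨ +-comm 2 (off t x) ⟩
  off t x + 2                  ≤⟨ +-monoʳ-≤ (off t x) (size≥2 t x) ⟩
  off t x + leaves (sub t x)   ≡⟨ sym (hi≡off+size t x) ⟩
  hi t x                       ≡⟨ hi≡suc-bₓ t x ⟩
  suc (bₓ t x)                 ∎)
  where open ≤-Reasoning

off<hi : ∀ t x → off t x < hi t x
off<hi t x = subst (off t x <_) (sym (hi≡suc-bₓ t x)) (m≤n⇒m≤1+n (aₓ<bₓ t x))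

mutual
  hi≤leaves : ∀ t x → hi t x ≤ leaves t
  hi≤leaves t here = ≤-refl
  hi≤leaves (node s u us) (inL p) =
    ≤-trans (hi≤leaves s p) (≤-trans (m≤m+n _ (leaves u)) (m≤m+n _ (leavesL us)))
  hi≤leaves (node s u us) (inM p) =
    ≤-trans (+-monoʳ-≤ (leaves s) (hi≤leaves u p)) (m≤m+n _ (leavesL us))
  hi≤leaves (node s u us) (inR p) = +-monoʳ-≤ (leaves s + leaves u) (hiL≤leavesL us p)

  hiL≤leavesL : ∀ ts x → hiL ts x ≤ leavesL ts
  hiL≤leavesL (u ∷ us) (hd p) = ≤-trans (hi≤leaves u p) (m≤m+n _ (leavesL us))
  hiL≤leavesL (u ∷ us) (tl p) = +-monoʳ-≤ (leaves u) (hiL≤leavesL us p)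

mutual
  below⇒nested : ∀ {t x y} → Below t y x → off t x ≤ off t y × hi t y ≤ hi t x
  below⇒nested {node s u us} (hL {p = p}) = z≤n , hi≤leaves (node s u us) (inL p)
  below⇒nested {node s u us} (hM {p = p}) = z≤n , hi≤leaves (node s u us) (inM p)
  below⇒nested {node s u us} (hR {p = p}) = z≤n , hi≤leaves (node s u us) (inR p)
  below⇒nested (lL b) = below⇒nested b
  below⇒nested {node s u us} (lM b) =
    Product.map (+-monoʳ-≤ (leaves s)) (+-monoʳ-≤ (leaves s)) (below⇒nested b)
  below⇒nested {node s u us} (lR b) =
    Product.map (+-monoʳ-≤ (leaves s + leaves u)) (+-monoʳ-≤ (leaves s + leaves u))
      (belowL⇒nested b)

  belowL⇒nested : ∀ {ts x y} → BelowL ts y x → offL ts x ≤ offL ts y × hiL ts y ≤ hiL ts x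
  belowL⇒nested (bhd b) = below⇒nested b
  belowL⇒nested {u ∷ us} (btl b) =
    Product.map (+-monoʳ-≤ (leaves u)) (+-monoʳ-≤ (leaves u)) (belowL⇒nested b)

left-before-middle : ∀ s u us p q → hi s p ≤ off (node s u us) (inM q)
left-before-middle s u us p q = ≤-trans (hi≤leaves s p) (m≤m+n _ _)

left-before-rest : ∀ s u us p q → hi s p ≤ off (node s u us) (inR q)
left-before-rest s u us p q =
  ≤-trans (hi≤leaves s p) (≤-trans (m≤m+n _ (leaves u)) (m≤m+n _ _))

middle-before-rest : ∀ s u us p q → hi (node s u us) (inM p) ≤ off (node s u us) (inR q)
middle-before-rest s u us p q = ≤-trans (+-monoʳ-≤ (leaves s) (hi≤leaves u p)) (m≤m+n _ _)

head-before-tail : ∀ u us p q → hi u p ≤ offL (u ∷ us) (tl q)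
head-before-tail u us p q = ≤-trans (hi≤leaves u p) (m≤m+n _ _)

Overlap : (t : Tree) → IPos t → IPos t → Set
Overlap t x y = off t x < hi t y × off t y < hi t x

OverlapL : (ts : List Tree) → IPosL ts → IPosL ts → Set
OverlapL ts x y = offL ts x < hiL ts y × offL ts y < hiL ts x

Comparable : (t : Tree) → IPos t → IPos t → Set
Comparable t x y = x ≡ y ⊎ Below t x y ⊎ Below t y x

ComparableL : (ts : List Tree) → IPosL ts → IPosL ts → Set
ComparableL ts x y = x ≡ y ⊎ BelowL ts x y ⊎ BelowL ts y x

root-or-below : ∀ {s u us} (y : IPos (node s u us)) → here ≡ y ⊎ Below (node s u us) y here
root-or-below here = inj₁ refl
root-or-below (inL p) = inj₂ hL
root-or-below (inM p) = inj₂ hM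
root-or-below (inR p) = inj₂ hR

-- Laminarity: overlapping ranges belong to comparable nodes.  Nodes in
-- different children have disjoint ranges; in the same child, recurse.
mutual
  overlap⇒comparable : ∀ t x y → Overlap t x y → Comparable t x y
  overlap⇒comparable (node s u us) here y _ = Sum.map₂ inj₂ (root-or-below y)
  overlap⇒comparable (node s u us) x here _ =
    Sum.[ inj₁ ∘ sym , inj₂ ∘ inj₁ ]′ (root-or-below x)
  overlap⇒comparable (node s u us) (inL p) (inL q) o =
    Sum.map (cong inL) (Sum.map lL lL) (overlap⇒comparable s p q o)
  overlap⇒comparable (node s u us) (inM p) (inM q) (o₁ , o₂) =
    Sum.map (cong inM) (Sum.map lM lM) (overlap⇒comparable u p q
      (+-cancelˡ-< (leaves s) _ _ o₁ , +-cancelˡ-< (leaves s) _ _ o₂))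
  overlap⇒comparable (node s u us) (inR p) (inR q) (o₁ , o₂) =
    Sum.map (cong inR) (Sum.map lR lR) (overlapL⇒comparable us p q
      (+-cancelˡ-< (leaves s + leaves u) _ _ o₁ , +-cancelˡ-< (leaves s + leaves u) _ _ o₂))
  overlap⇒comparable (node s u us) (inL p) (inM q) o =
    ⊥-elim (<⇒≱ (proj₂ o) (left-before-middle s u us p q))
  overlap⇒comparable (node s u us) (inM p) (inL q) o =
    ⊥-elim (<⇒≱ (proj₁ o) (left-before-middle s u us q p))
  overlap⇒comparable (node s u us) (inL p) (inR q) o =
    ⊥-elim (<⇒≱ (proj₂ o) (left-before-rest s u us p q))
  overlap⇒comparable (node s u us) (inR p) (inL q) o =
    ⊥-elim (<⇒≱ (proj₁ o) (left-before-rest s u us q p))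
  overlap⇒comparable (node s u us) (inM p) (inR q) o =
    ⊥-elim (<⇒≱ (proj₂ o) (middle-before-rest s u us p q))
  overlap⇒comparable (node s u us) (inR p) (inM q) o =
    ⊥-elim (<⇒≱ (proj₁ o) (middle-before-rest s u us q p))

  overlapL⇒comparable : ∀ ts x y → OverlapL ts x y → ComparableL ts x y
  overlapL⇒comparable (u ∷ us) (hd p) (hd q) o =
    Sum.map (cong hd) (Sum.map bhd bhd) (overlap⇒comparable u p q o)
  overlapL⇒comparable (u ∷ us) (tl p) (tl q) (o₁ , o₂) =
    Sum.map (cong tl) (Sum.map btl btl) (overlapL⇒comparable us p q
      (+-cancelˡ-< (leaves u) _ _ o₁ , +-cancelˡ-< (leaves u) _ _ o₂))
  overlapL⇒comparable (u ∷ us) (hd p) (tl q) o =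
    ⊥-elim (<⇒≱ (proj₂ o) (head-before-tail u us p q))
  overlapL⇒comparable (u ∷ us) (tl p) (hd q) o =
    ⊥-elim (<⇒≱ (proj₁ o) (head-before-tail u us q p))

mutual
  anyPos? : ∀ t (P : IPos t → Set) → (∀ x → Dec (P x)) → Dec (Σ (IPos t) P)
  anyPos? leaf P P? = no λ { (() , _) }
  anyPos? (node s u us) P P? with P? here
  ... | yes ph = yes (here , ph)
  ... | no ¬ph with anyPos? s (P ∘ inL) (P? ∘ inL)
  ... | yes (x , px) = yes (inL x , px)
  ... | no ¬pl with anyPos? u (P ∘ inM) (P? ∘ inM)
  ... | yes (x , px) = yes (inM x , px)
  ... | no ¬pm with anyPosL? us (P ∘ inR) (P? ∘ inR)
  ... | yes (x , px) = yes (inR x , px)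
  ... | no ¬pr = no λ { (here , p) → ¬ph p ; (inL x , p) → ¬pl (x , p)
                      ; (inM x , p) → ¬pm (x , p) ; (inR x , p) → ¬pr (x , p) }

  anyPosL? : ∀ ts (P : IPosL ts → Set) → (∀ x → Dec (P x)) → Dec (Σ (IPosL ts) P)
  anyPosL? [] P P? = no λ { (() , _) }
  anyPosL? (u ∷ us) P P? with anyPos? u (P ∘ hd) (P? ∘ hd)
  ... | yes (x , px) = yes (hd x , px)
  ... | no ¬ph with anyPosL? us (P ∘ tl) (P? ∘ tl)
  ... | yes (x , px) = yes (tl x , px)
  ... | no ¬pt = no λ { (hd x , p) → ¬ph (x , p) ; (tl x , p) → ¬pt (x , p) }

mutual
  topmost : ∀ t (P : IPos t → Set) → (∀ x → Dec (P x)) → ∀ y → P y →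
    Σ (IPos t) λ x → P x × (y ≡ x ⊎ Below t y x) × (∀ z → Below t x z → ¬ P z)
  topmost (node s u us) P P? here py = here , py , inj₁ refl , λ _ ()
  topmost (node s u us) P P? (inL p) py with P? here
  ... | yes ph = here , ph , inj₂ hL , λ _ ()
  ... | no ¬ph with topmost s (P ∘ inL) (P? ∘ inL) p py
  ... | x , px , y⊑x , top =
    inL x , px , Sum.map (cong inL) lL y⊑x , λ { _ hL → ¬ph ; _ (lL b) → top _ b }
  topmost (node s u us) P P? (inM p) py with P? here
  ... | yes ph = here , ph , inj₂ hM , λ _ ()
  ... | no ¬ph with topmost u (P ∘ inM) (P? ∘ inM) p py
  ... | x , px , y⊑x , top =
    inM x , px , Sum.map (cong inM) lM y⊑x , λ { _ hM → ¬ph ; _ (lM b) → top _ b }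
  topmost (node s u us) P P? (inR p) py with P? here
  ... | yes ph = here , ph , inj₂ hR , λ _ ()
  ... | no ¬ph with topmostL us (P ∘ inR) (P? ∘ inR) p py
  ... | x , px , y⊑x , top =
    inR x , px , Sum.map (cong inR) lR y⊑x , λ { _ hR → ¬ph ; _ (lR b) → top _ b }

  topmostL : ∀ ts (P : IPosL ts → Set) → (∀ x → Dec (P x)) → ∀ y → P y →
    Σ (IPosL ts) λ x → P x × (y ≡ x ⊎ BelowL ts y x) × (∀ z → BelowL ts x z → ¬ P z)
  topmostL (u ∷ us) P P? (hd p) py with topmost u (P ∘ hd) (P? ∘ hd) p py
  ... | x , px , y⊑x , top =
    hd x , px , Sum.map (cong hd) bhd y⊑x , λ { _ (bhd b) → top _ b }
  topmostL (u ∷ us) P P? (tl p) py with topmostL us (P ∘ tl) (P? ∘ tl) p py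
  ... | x , px , y⊑x , top =
    tl x , px , Sum.map (cong tl) btl y⊑x , λ { _ (btl b) → top _ b }

Spans : (t : Tree) → ℕ → IPos t → Set
Spans t m x = off t x < m × m < hi t x

spans? : ∀ t m x → Dec (Spans t m x)
spans? t m x = (off t x <? m) ×-dec (m <? hi t x)

≤bₓ⇔<hi : ∀ t x m → m ≤ bₓ t x ⇔ m < hi t x
≤bₓ⇔<hi t x m rewrite hi≡suc-bₓ t x = mk⇔ s≤s s≤s⁻¹

commonAnc⇔spans : ∀ t j x → CommonAnc t (suc j) x ⇔ Spans t (suc j) x
commonAnc⇔spans t j x = mk⇔
  (λ { ((a≤j , _) , (_ , j+1≤b)) → s≤s a≤j , to (≤bₓ⇔<hi t x (suc j)) j+1≤b })
  (λ { (s≤s a≤j , j+1<hi) → let j+1≤b = from (≤bₓ⇔<hi t x (suc j)) j+1<hi in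
        (a≤j , ≤-trans (n≤1+n j) j+1≤b) , (m≤n⇒m≤1+n a≤j , j+1≤b) })

spans-up : ∀ {t m y x} → y ≡ x ⊎ Below t y x → Spans t m y → Spans t m x
spans-up (inj₁ refl) sp = sp
spans-up (inj₂ y<x) (a<m , m<h) =
  ≤-<-trans (proj₁ (below⇒nested y<x)) a<m , <-≤-trans m<h (proj₂ (below⇒nested y<x))

spans⇒<leaves : ∀ {t m x} → Spans t m x → m < leaves t
spans⇒<leaves {t} {x = x} (_ , m<h) = <-≤-trans m<h (hi≤leaves t x)

-- Among the nodes satisfying a decidable P, descending through strictly
-- smaller levels reaches one with no proper descendant satisfying P (proper
-- descendants have smaller level), at level at most the starting one.
levelMinimal : (T : Leveled) (P : IPos (tree T) → Set) → (∀ x → Dec (P x)) →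
  ∀ x → P x → Σ (IPos (tree T)) λ y →
    (P y × (∀ w → Below (tree T) w y → ¬ P w)) × lev T y F.≤ lev T x
levelMinimal T P P? x₀ px₀ = descend x₀ (<-wellFounded (lev T x₀)) px₀
  where
  descend : ∀ x → Acc F._<_ (lev T x) → P x → Σ (IPos (tree T)) λ y →
    (P y × (∀ w → Below (tree T) w y → ¬ P w)) × lev T y F.≤ lev T x
  descend x (acc smaller) px
    with anyPos? (tree T) (λ z → P z × lev T z F.< lev T x)
                          (λ z → P? z ×-dec (lev T z FP.<? lev T x))
  ... | yes (z , pz , z<x) with descend z (smaller z<x) pz
  ... | y , minimal , y≤z = y , minimal , ≤-trans y≤z (<⇒≤ z<x)
  descend x (acc smaller) px | no none =
    x , (px , λ w w<x pw → none (w , pw , mono T w x w<x)) , ≤-refl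

module LevelTubes (T : Leveled) {n : ℕ} (size : leaves (tree T) ≡ suc n) where

  t : Tree
  t = tree T

  Reach : Fin (k T) → ℕ → Set
  Reach i m = ∃[ x ] (Spans t m x × lev T x F.≤ i)

  reach? : ∀ i m → Dec (Reach i m)
  reach? i m = anyPos? t _ (λ x → spans? t m x ×-dec (lev T x FP.≤? i))

  IsLevelTube : Subset n → Fin (k T) → Set
  IsLevelTube Y i =
    ∀ j → (j ∈ Y) ⇔ (∃[ x ] (Assigned t (suc (toℕ j)) x × lev T x F.≤ i))

  -- A gap is assigned to a node of level ≤ i iff it is in Dᵢ; the node it
  -- is assigned to is a lowest spanning node, found by levelMinimal.
  assigned⇔reach : ∀ i j → (∃[ x ] (Assigned t (suc j) x × lev T x F.≤ i)) ⇔ Reach i (suc j)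
  assigned⇔reach i j = mk⇔
    (λ { (x , (ca , _) , x≤i) → x , to (commonAnc⇔spans t j x) ca , x≤i })
    (λ { (x , sp , x≤i) → lowest x x≤i (levelMinimal T (Spans t (suc j)) (spans? t (suc j)) x sp) })
    where
    lowest : ∀ x → lev T x F.≤ i →
      Σ (IPos t) (λ y → (Spans t (suc j) y × (∀ w → Below t w y → ¬ Spans t (suc j) w))
                        × lev T y F.≤ lev T x) →
      ∃[ y ] (Assigned t (suc j) y × lev T y F.≤ i)
    lowest x x≤i (y , (sp , low) , y≤x) =
      y , (from (commonAnc⇔spans t j y) sp , λ w w<y → low w w<y ∘ to (commonAnc⇔spans t j w))
        , ≤-trans y≤x x≤i

  -- Gaps of Dᵢ lie in [n], so a level tube is exactly Dᵢ.
  In⇔Reach : ∀ {Y i} → IsLevelTube Y i → ∀ m → In Y m ⇔ Reach i m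
  In⇔Reach {Y} {i} tube m = mk⇔ inY⇒reach (reach⇒inY m)
    where
    inY⇒reach : In Y m → Reach i m
    inY⇒reach (j , refl , j∈Y) = to (assigned⇔reach i (toℕ j)) (to (tube j) j∈Y)

    reach⇒inY : ∀ m → Reach i m → In Y m
    reach⇒inY zero (_ , (() , _) , _)
    reach⇒inY (suc m) r@(x , sp , _) =
      j , cong suc toℕj≡m ,
      from (tube j) (from (assigned⇔reach i (toℕ j)) (subst (Reach i ∘ suc) (sym toℕj≡m) r))
      where
      m<n : m < n
      m<n = s≤s⁻¹ (subst (suc m <_) size (spans⇒<leaves {t} {x = x} sp))
      j : Fin n
      j = fromℕ< m<n
      toℕj≡m : toℕ j ≡ m
      toℕj≡m = FP.toℕ-fromℕ< m<n

  reachSet : Fin (k T) → Subset n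
  reachSet i = tabulate (λ j → isYes (reach? i (suc (toℕ j))))

  ∈reachSet⇔ : ∀ i j → j ∈ reachSet i ⇔ Reach i (suc (toℕ j))
  ∈reachSet⇔ i j = mk⇔
    (λ j∈ → toWitness {a? = reach? i _}
              (from T-≡ (trans (sym (lookup∘tabulate _ j)) ([]=⇒lookup j∈))))
    (λ r → lookup⇒[]= j (reachSet i)
              (trans (lookup∘tabulate _ j) (to T-≡ (fromWitness {a? = reach? i _} r))))

  reachSet-isLevelTube : ∀ i → IsLevelTube (reachSet i) i
  reachSet-isLevelTube i j = ⇔.trans (∈reachSet⇔ i j) (⇔.sym (assigned⇔reach i (toℕ j)))

  Topmost : Fin (k T) → IPos t → Set
  Topmost i x = ∀ z → Below t x z → ¬ lev T z F.≤ i

  -- The gaps just outside the range of a topmost node are not in Dᵢ: a node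
  -- spanning one of them would overlap x, hence be comparable with x, yet
  -- it can be neither x, nor below x, nor (by topmostness) above x.
  left∉Reach : ∀ {i x} → Topmost i x → ¬ Reach i (off t x)
  left∉Reach {x = x} top (y , (y< , <y) , y≤i)
    with overlap⇒comparable t x y (<y , <-trans y< (off<hi t x))
  ... | inj₁ refl = <-irrefl refl y<
  ... | inj₂ (inj₁ x<y) = top y x<y y≤i
  ... | inj₂ (inj₂ y<x) = <⇒≱ y< (proj₁ (below⇒nested y<x))

  right∉Reach : ∀ {i x} → Topmost i x → ¬ Reach i (hi t x)
  right∉Reach {x = x} top (y , (y< , <y) , y≤i)
    with overlap⇒comparable t x y (<-trans (off<hi t x) <y , y<)
  ... | inj₁ refl = <-irrefl refl <y
  ... | inj₂ (inj₁ x<y) = top y x<y y≤i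
  ... | inj₂ (inj₂ y<x) = <⇒≱ <y (proj₂ (below⇒nested y<x))

  node⇒component : ∀ X → g n t X → ΘP n (f n T) X
  node⇒component X (x , interval) =
    reachSet i , (i , tube) , (aₓ t x , bₓ t x , aₓ<bₓ t x , interval , inside , left , right)
    where
    i = lev T x
    tube = reachSet-isLevelTube i
    top : Topmost i x
    top z x<z z≤i = <⇒≱ (mono T x z x<z) z≤i
    inside : ∀ m → aₓ t x < m → m ≤ bₓ t x → In (reachSet i) m
    inside m a<m m≤b = from (In⇔Reach tube m) (x , (a<m , to (≤bₓ⇔<hi t x m) m≤b) , ≤-refl)
    left : ¬ In (reachSet i) (aₓ t x)
    left = left∉Reach top ∘ to (In⇔Reach tube _)
    right : ¬ In (reachSet i) (suc (bₓ t x))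
    right = right∉Reach top ∘ subst (Reach i) (sym (hi≡suc-bₓ t x)) ∘ to (In⇔Reach tube _)

  -- A node of level ≤ i spanning the first gap a+1 of a run of a level tube
  -- that does not contain a starts at leaf a: otherwise it would span a.
  off≡start : ∀ {Y i a x} → IsLevelTube Y i → ¬ In Y a →
    lev T x F.≤ i → Spans t (suc a) x → off t x ≡ a
  off≡start {Y} {a = a} {x} tube a∉ x≤i (x<a+1 , a+1<hi) =
    ≤-antisym (s≤s⁻¹ x<a+1) (≮⇒≥ λ x<a →
      a∉ (from (In⇔Reach tube a) (x , (x<a , <-trans (n<1+n a) a+1<hi) , x≤i)))

  -- A topmost node spanning the first gap of a maximal run {a+1,…,b} of a
  -- level tube ends at leaf b: past it, it would span b+1; before it, its
  -- right outer gap would be in the run.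
  hi≡end : ∀ {Y i a b x} → IsLevelTube Y i → a < b →
    (∀ m → a < m → m ≤ b → In Y m) → ¬ In Y (suc b) →
    lev T x F.≤ i → Topmost i x → Spans t (suc a) x → hi t x ≡ suc b
  hi≡end {Y} {a = a} {b} {x} tube a<b run b+1∉ x≤i top (x<a+1 , a+1<hi) =
    ≤-antisym (≮⇒≥ beyond) (≮⇒≥ short)
    where
    beyond : ¬ suc b < hi t x
    beyond b+1<hi = b+1∉ (from (In⇔Reach tube (suc b))
      (x , (<-≤-trans x<a+1 (s≤s (<⇒≤ a<b)) , b+1<hi) , x≤i))
    short : ¬ hi t x < suc b
    short hi≤b = right∉Reach top
      (to (In⇔Reach tube (hi t x)) (run (hi t x) (<-trans (n<1+n a) a+1<hi) (s≤s⁻¹ hi≤b)))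

  -- (⊇) A component {a+1,…,b} of Dᵢ is the interval of the topmost node of
  -- level ≤ i above a node of level ≤ i spanning a+1.
  component⇒node : ∀ X → ΘP n (f n T) X → g n t X
  component⇒node X (Y , (i , tube) , (a , b , a<b , interval , run , a∉ , b+1∉))
    with to (In⇔Reach tube (suc a)) (run (suc a) ≤-refl a<b)
  ... | y , y-spans , y≤i
    with topmost t (λ z → lev T z F.≤ i) (λ z → lev T z FP.≤? i) y y≤i
  ... | x , x≤i , y⊑x , top =
    x , subst₂ (IsInterval X) (sym off≡a) (sym bₓ≡b) interval
    where
    x-spans : Spans t (suc a) x
    x-spans = spans-up y⊑x y-spans
    off≡a : aₓ t x ≡ a
    off≡a = off≡start tube a∉ x≤i x-spans
    bₓ≡b : bₓ t x ≡ b
    bₓ≡b = suc-injective (trans (sym (hi≡suc-bₓ t x))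
      (hi≡end tube a<b run b+1∉ x≤i top x-spans))

theorem3p5 : (n : ℕ) → 1 ≤ n → (T : Leveled) → leaves (Θ T) ≡ suc n →
    (X : Subset n) → g n (Θ T) X ⇔ ΘP n (f n T) X
theorem3p5 n _ T size X = mk⇔ (node⇒component X) (component⇒node X)
  where open LevelTubes T size
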